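{- Let $H$ be a finite graph with $i_{1,1}(H)=1$. Then for every integer $p$ with $1\le p\le |V(H)|-1$ there exists $S\subseteq V(H)$ with $|S|=p$ and $|N(S)-S|\le 1$.
   Context: Discrete-time immunization model with $r=s=1$. For a finite graph $H$, a protocol is a finite sequence $(A_1,\dots,A_N)$ of subsets of $V(H)$ (vertices immunized at time-step $t$); its width is $\max_i|A_i|$. At time $0$ all vertices are red. For $t\ge1$ each vertex is green, yellow or red at time $t$: if $v\in A_t$ then $v$ is green; otherwise, a vertex red or yellow at time $t-1$ is red at time $t$, and a vertex green at time $t-1$ becomes yellow at time $t$ if it has a neighbor that is red at time $t$, and stays green otherwise. The protocol clears $H$ if all vertices are green at time $N$. $i_{1,1}(H)$ is the minimum width of a protocol that clears $H$. For $S\subseteq V(H)$, $N(S)=\bigcup_{x\in S}N(x)$. -}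

module Defs where

open import Data.Nat using (ℕ; _⊔_; _≤_)
open import Data.Bool using (Bool; true; false; not; _∧_; if_then_else_)
open import Data.Fin using (Fin)
open import Data.Fin.Subset using (Subset; ∣_∣)
open import Data.Vec using (lookup; tabulate)
open import Data.List using (List; allFin; foldl; foldr; map)
open import Data.Bool.ListAction using (any)
open import Data.Product using (Σ; _×_)
open import Relation.Binary.PropositionalEquality using (_≡_)

record Graph (n : ℕ) : Set where
  field
    adj   : Fin n → Fin n → Bool
    sym   : ∀ u v → adj u v ≡ adj v u
    irref : ∀ v → adj v v ≡ false
open Graph public

data Colour : Set where
  green yellow red : Colour

isGreen : Colour → Bool
isGreen green  = true
isGreen yellow = false
isGreen red    = false

State : ℕ → Set
State n = Fin n → Colour

allRed : ∀ {n} → State n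
allRed _ = red

-- One time-step: A is the set A_t immunized at time t, c is the state at t-1.
step : ∀ {n} → Graph n → State n → Subset n → State n
step {n} G c A v with lookup A v | isGreen (c v)
... | true  | _     = green
... | false | false = red
... | false | true  =
  if any (λ u → adj G v u ∧ redNow u) (allFin n) then yellow else green
  where
  -- u is red at time t iff u ∉ A_t and u was not green at time t-1
  redNow : Fin n → Bool
  redNow u = not (lookup A u) ∧ not (isGreen (c u))

Protocol : ℕ → Set
Protocol n = List (Subset n)

run : ∀ {n} → Graph n → Protocol n → State n
run G P = foldl (step G) allRed P

Clears : ∀ {n} → Graph n → Protocol n → Set
Clears G P = ∀ v → run G P v ≡ green

width : ∀ {n} → Protocol n → ℕ
width P = foldr _⊔_ 0 (map ∣_∣ P)

i11≡ : ∀ {n} → Graph n → ℕ → Set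
i11≡ G k = Σ (Protocol _) (λ P → Clears G P × width P ≡ k)
         × (∀ P → Clears G P → k ≤ width P)

N : ∀ {n} → Graph n → Subset n → Subset n
N {n} G S = tabulate (λ v → any (λ x → lookup S x ∧ adj G x v) (allFin n))

-- Count the green vertices along a clearing protocol of width 1: the count
-- starts at 0 and ends at |V(H)|, so at some step t it jumps from at most p to
-- more than p.  Every vertex green at time t lies in A_t or in the set S of
-- vertices that were green at t-1, were not immunized at t and are still green
-- at t; as |A_t| ≤ 1 this forces |S| = p and S = (green at t-1).  A vertex of S
-- stays green only if none of its neighbours is red at t, so every neighbour
-- outside S is in A_t, whence |N(S) - S| ≤ |A_t| ≤ 1.
module Submission where

open import Defs
open import Data.Nat using (ℕ; _≤_; _∸_)
open import Data.Fin.Subset using (Subset; ∣_∣; _─_)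
open import Data.Product using (Σ; _×_)
open import Relation.Binary.PropositionalEquality using (_≡_)

open import Data.Nat using (zero; suc; _+_; _<_; _<?_; z≤n; s≤s)
open import Data.Nat.Properties
open import Data.Bool using (Bool; true; false; not; _∧_; T)
open import Data.Bool.Properties using (T-≡; T-∧; ¬-not)
open import Data.Bool.ListAction using (any)
open import Data.Fin using (Fin)
open import Data.Fin.Subset using (_∈_; _∉_; _⊆_; _∪_; _∩_; ∁; ⊤; ⊥; inside; outside)
open import Data.Fin.Subset.Properties
open import Data.Vec using ([]; _∷_; lookup; tabulate; here; there)
open import Data.Vec.Properties using (lookup∘tabulate; []=⇒lookup; lookup⇒[]=)
open import Data.List using (List; []; _∷_; foldl; allFin)
open import Data.List.Relation.Unary.Any using (here; there; satisfied)
open import Data.List.Relation.Unary.Any.Properties using (any⁺; any⁻)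
open import Data.List.Membership.Propositional using (lose)
import Data.List.Membership.Propositional as List
open import Data.List.Membership.Propositional.Properties using (∈-allFin)
open import Data.Product using (∃; ∃₂; _,_; proj₁; proj₂)
open import Data.Sum using (_⊎_; inj₁; inj₂)
open import Function using (_∘_; Equivalence)
open import Relation.Nullary using (yes; no; contradiction)
open import Relation.Binary.PropositionalEquality using (refl; trans; cong; cong₂) renaming (sym to ≡-sym)

open Equivalence using (to; from)

private
  variable
    n : ℕ

∣p∪q∣≤∣p∣+∣q∣ : (p q : Subset n) → ∣ p ∪ q ∣ ≤ ∣ p ∣ + ∣ q ∣
∣p∪q∣≤∣p∣+∣q∣ []            []            = z≤n
∣p∪q∣≤∣p∣+∣q∣ (outside ∷ p) (outside ∷ q) = ∣p∪q∣≤∣p∣+∣q∣ p q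
∣p∪q∣≤∣p∣+∣q∣ (outside ∷ p) (inside  ∷ q) =
  ≤-trans (s≤s (∣p∪q∣≤∣p∣+∣q∣ p q)) (≤-reflexive (≡-sym (+-suc ∣ p ∣ ∣ q ∣)))
∣p∪q∣≤∣p∣+∣q∣ (inside  ∷ p) (x       ∷ q) =
  s≤s (≤-trans (∣p∪q∣≤∣p∣+∣q∣ p q) (+-monoʳ-≤ ∣ p ∣ (∣p∣≤∣x∷p∣ x q)))

p⊆q⇒∣q∣≤∣p∣⇒q⊆p : {p q : Subset n} → p ⊆ q → ∣ q ∣ ≤ ∣ p ∣ → q ⊆ p
p⊆q⇒∣q∣≤∣p∣⇒q⊆p {p = p} p⊆q ∣q∣≤∣p∣ {x} x∈q with x ∈? p
... | yes x∈p = x∈p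
... | no  x∉p = contradiction (p⊂q⇒∣p∣<∣q∣ (p⊆q , x , x∈q , x∉p)) (≤⇒≯ ∣q∣≤∣p∣)

x∈p─q⁻ : ∀ {x : Fin n} (p q : Subset n) → x ∈ p ─ q → x ∈ p × x ∉ q
x∈p─q⁻ (_      ∷ p) (_       ∷ q) (there m) =
  there (proj₁ (x∈p─q⁻ p q m)) , proj₂ (x∈p─q⁻ p q m) ∘ drop-there
x∈p─q⁻ (inside ∷ p) (outside ∷ q) here      = here , λ ()

∈-tabulate⁺ : ∀ {f : Fin n → Bool} {x} → f x ≡ true → x ∈ tabulate f
∈-tabulate⁺ {f = f} {x} fx = lookup⇒[]= x (tabulate f) (trans (lookup∘tabulate f x) fx)

∈-tabulate⁻ : ∀ {f : Fin n → Bool} {x} → x ∈ tabulate f → f x ≡ true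
∈-tabulate⁻ {f = f} {x} x∈ = trans (≡-sym (lookup∘tabulate f x)) ([]=⇒lookup x∈)

∉-tabulate⁻ : ∀ {f : Fin n → Bool} {x} → x ∉ tabulate f → f x ≡ false
∉-tabulate⁻ x∉ = ¬-not (x∉ ∘ ∈-tabulate⁺)

∉⇒lookup≡false : ∀ (p : Subset n) {x} → x ∉ p → lookup p x ≡ false
∉⇒lookup≡false p {x} x∉p = ¬-not (x∉p ∘ lookup⇒[]= x p)

any-allFin⁺ : (f : Fin n → Bool) (x : Fin n) → f x ≡ true → any f (allFin n) ≡ true
any-allFin⁺ f x fx = to T-≡ (any⁺ f (lose (∈-allFin x) (from T-≡ fx)))

any-allFin⁻ : (f : Fin n → Bool) → any f (allFin n) ≡ true → ∃ λ x → f x ≡ true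
any-allFin⁻ f any≡true with satisfied (any⁻ f (allFin _) (from T-≡ any≡true))
... | x , Tfx = x , to T-≡ Tfx

∈N⁻ : (H : Graph n) (S : Subset n) {v : Fin n} → v ∈ N H S → ∃ λ x → x ∈ S × adj H x v ≡ true
∈N⁻ H S {v} v∈N with any-allFin⁻ _ (∈-tabulate⁻ v∈N)
... | x , Sx∧xv = x , lookup⇒[]= x S (to T-≡ (proj₁ Tboth)) , to T-≡ (proj₂ Tboth)
  where
  Tboth : T (lookup S x) × T (adj H x v)
  Tboth = to T-∧ (from T-≡ Sx∧xv)

greens : State n → Subset n
greens c = tabulate (λ v → isGreen (c v))

steady : Graph n → State n → Subset n → Subset n
steady H c A = greens c ∩ ∁ A ∩ greens (step H c A)

green-after-step : (H : Graph n) (c : State n) (A : Subset n) (v : Fin n) →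
  isGreen (step H c A v) ≡ true → lookup A v ≡ true ⊎ isGreen (c v) ≡ true
green-after-step H c A v v-green with lookup A v | isGreen (c v)
... | true  | _     = inj₁ refl
... | false | true  = inj₂ refl
... | false | false with () ← v-green

-- The local redNow of step, named so that rewriting can match the neighbour test.
red-after-step : State n → Subset n → Fin n → Bool
red-after-step c A u = not (lookup A u) ∧ not (isGreen (c u))

green-beside-red-turns-yellow : (H : Graph n) (c : State n) (A : Subset n) {x u : Fin n} →
  lookup A x ≡ false → isGreen (c x) ≡ true →
  adj H x u ≡ true → lookup A u ≡ false → isGreen (c u) ≡ false →
  step H c A x ≡ yellow
green-beside-red-turns-yellow H c A {x} {u} x∉A x-green xu u∉A u-red
  rewrite x∉A | x-green
        | any-allFin⁺ (λ w → adj H x w ∧ red-after-step c A w) u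
            (cong₂ _∧_ xu (cong₂ (λ a b → not a ∧ not b) u∉A u-red)) = refl

greens-step⊆steady∪A : (H : Graph n) (c : State n) (A : Subset n) →
  greens (step H c A) ⊆ steady H c A ∪ A
greens-step⊆steady∪A H c A {v} v∈G′ with v ∈? A
... | yes v∈A = x∈p∪q⁺ (inj₂ v∈A)
... | no  v∉A with green-after-step H c A v (∈-tabulate⁻ v∈G′)
...   | inj₁ v∈A  = contradiction (lookup⇒[]= v A v∈A) v∉A
...   | inj₂ v∈G = x∈p∪q⁺ (inj₁ (x∈p∩q⁺ (∈-tabulate⁺ v∈G , x∈p∩q⁺ (x∉p⇒x∈∁p v∉A , v∈G′))))

∈steady⁻ : (H : Graph n) (c : State n) (A : Subset n) {x : Fin n} → x ∈ steady H c A →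
  isGreen (c x) ≡ true × lookup A x ≡ false × isGreen (step H c A x) ≡ true
∈steady⁻ H c A x∈S with x∈p∩q⁻ (greens c) _ x∈S
... | x∈G , x∈∁A∩G′ with x∈p∩q⁻ (∁ A) _ x∈∁A∩G′
...   | x∈∁A , x∈G′ =
  ∈-tabulate⁻ x∈G , ∉⇒lookup≡false A (x∈∁p⇒x∉p x∈∁A) , ∈-tabulate⁻ x∈G′

N-steady⊆greens∪A : (H : Graph n) (c : State n) (A : Subset n) →
  N H (steady H c A) ⊆ greens c ∪ A
N-steady⊆greens∪A H c A {v} v∈N with ∈N⁻ H (steady H c A) v∈N
... | x , x∈S , xv with ∈steady⁻ H c A x∈S | v ∈? greens c | v ∈? A
...   | _ | yes v∈G | _       = x∈p∪q⁺ (inj₁ v∈G)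
...   | _ | no  _   | yes v∈A = x∈p∪q⁺ (inj₂ v∈A)
...   | x-green , x∉A , x-stays-green | no v∉G | no v∉A with () ←
  trans (≡-sym x-stays-green)
    (cong isGreen (green-beside-red-turns-yellow H c A x∉A x-green xv
      (∉⇒lookup≡false A v∉A) (∉-tabulate⁻ v∉G)))

crossing-step : (H : Graph n) (c : State n) (A : Subset n) {q : ℕ} →
  ∣ A ∣ ≤ 1 → ∣ greens c ∣ ≤ q → q < ∣ greens (step H c A) ∣ →
  ∣ steady H c A ∣ ≡ q × N H (steady H c A) ─ steady H c A ⊆ A
crossing-step {n} H c A {q} ∣A∣≤1 ∣G∣≤q q<∣G′∣ = ≤-antisym ∣S∣≤q q≤∣S∣ , N─S⊆A
  where
  S : Subset n
  S = steady H c A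

  G : Subset n
  G = greens c

  S⊆G : S ⊆ G
  S⊆G = p∩q⊆p G _

  ∣S∣≤q : ∣ S ∣ ≤ q
  ∣S∣≤q = ≤-trans (p⊆q⇒∣p∣≤∣q∣ S⊆G) ∣G∣≤q

  q≤∣S∣ : q ≤ ∣ S ∣
  q≤∣S∣ = ≤-pred (begin-strict
    q                       <⟨ q<∣G′∣ ⟩
    ∣ greens (step H c A) ∣ ≤⟨ p⊆q⇒∣p∣≤∣q∣ (greens-step⊆steady∪A H c A) ⟩
    ∣ S ∪ A ∣               ≤⟨ ∣p∪q∣≤∣p∣+∣q∣ S A ⟩
    ∣ S ∣ + ∣ A ∣           ≤⟨ +-monoʳ-≤ ∣ S ∣ ∣A∣≤1 ⟩
    ∣ S ∣ + 1               ≡⟨ +-comm ∣ S ∣ 1 ⟩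
    suc ∣ S ∣               ∎)
    where open ≤-Reasoning

  G⊆S : G ⊆ S
  G⊆S = p⊆q⇒∣q∣≤∣p∣⇒q⊆p S⊆G (≤-trans ∣G∣≤q q≤∣S∣)

  N─S⊆A : N H S ─ S ⊆ A
  N─S⊆A {v} v∈N─S with x∈p─q⁻ (N H S) S v∈N─S
  ... | v∈N , v∉S with x∈p∪q⁻ G A (N-steady⊆greens∪A H c A v∈N)
  ...   | inj₁ v∈G = contradiction (G⊆S v∈G) v∉S
  ...   | inj₂ v∈A = v∈A

foldl-crossing : ∀ {a b} {A : Set a} {B : Set b} (f : B → A → B) (μ : B → ℕ) {q : ℕ}
  (z : B) (xs : List A) → μ z ≤ q → q < μ (foldl f z xs) →
  ∃₂ λ y x → x List.∈ xs × μ y ≤ q × q < μ (f y x)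
foldl-crossing f μ z []       μz≤q q<μz = contradiction μz≤q (<⇒≱ q<μz)
foldl-crossing f μ {q} z (x ∷ xs) μz≤q q<end with q <? μ (f z x)
... | yes q<μfzx = z , x , here refl , μz≤q , q<μfzx
... | no  q≮μfzx with foldl-crossing f μ (f z x) xs (≮⇒≥ q≮μfzx) q<end
...   | y , x′ , x′∈xs , crossing = y , x′ , there x′∈xs , crossing

∈⇒∣∣≤width : {A : Subset n} {P : Protocol n} → A List.∈ P → ∣ A ∣ ≤ width P
∈⇒∣∣≤width {A = A} {P ∷ Ps} (here refl) = m≤m⊔n ∣ A ∣ (width Ps)
∈⇒∣∣≤width {P = P ∷ Ps} (there A∈Ps) = ≤-trans (∈⇒∣∣≤width A∈Ps) (m≤n⊔m ∣ P ∣ (width Ps))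

∣greens-allRed∣≡0 : ∣ greens (allRed {n}) ∣ ≡ 0
∣greens-allRed∣≡0 {n} = n≤0⇒n≡0 (≤-trans (p⊆q⇒∣p∣≤∣q∣ greens⊆⊥) (≤-reflexive (∣⊥∣≡0 n)))
  where
  greens⊆⊥ : greens (allRed {n}) ⊆ ⊥
  greens⊆⊥ x∈ with () ← ∈-tabulate⁻ x∈

clears⇒∣greens∣≡n : (H : Graph n) (P : Protocol n) → Clears H P → ∣ greens (run H P) ∣ ≡ n
clears⇒∣greens∣≡n {n} H P clears =
  ≤-antisym (∣p∣≤n (greens (run H P)))
            (≤-trans (≤-reflexive (≡-sym (∣⊤∣≡n n))) (p⊆q⇒∣p∣≤∣q∣ ⊤⊆greens))
  where
  ⊤⊆greens : ⊤ {n} ⊆ greens (run H P)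
  ⊤⊆greens {v} _ = ∈-tabulate⁺ (cong isGreen (clears v))

positive∧≤n∸1⇒<n : ∀ {m n} → 1 ≤ m → m ≤ n ∸ 1 → m < n
positive∧≤n∸1⇒<n {n = zero}  (s≤s z≤n) ()
positive∧≤n∸1⇒<n {n = suc n} _         m≤n = s≤s m≤n

lemma4p1 : (n : ℕ) (H : Graph n) → i11≡ H 1 →
    (p : ℕ) → 1 ≤ p → p ≤ n ∸ 1 →
    Σ (Subset n) (λ S → ∣ S ∣ ≡ p × ∣ N H S ─ S ∣ ≤ 1)
lemma4p1 n H ((P , clears , width≡1) , _) p 1≤p p≤n∸1 =
  let c , A , A∈P , ∣G∣≤p , p<∣G′∣ = foldl-crossing (step H) (∣_∣ ∘ greens) allRed P start finish
      ∣A∣≤1 : ∣ A ∣ ≤ 1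
      ∣A∣≤1 = ≤-trans (∈⇒∣∣≤width A∈P) (≤-reflexive width≡1)
      ∣S∣≡p , N─S⊆A = crossing-step H c A ∣A∣≤1 ∣G∣≤p p<∣G′∣
  in steady H c A , ∣S∣≡p , ≤-trans (p⊆q⇒∣p∣≤∣q∣ N─S⊆A) ∣A∣≤1
  where
  start : ∣ greens (allRed {n}) ∣ ≤ p
  start = ≤-trans (≤-reflexive (∣greens-allRed∣≡0 {n})) z≤n

  finish : p < ∣ greens (run H P) ∣
  finish = ≤-trans (positive∧≤n∸1⇒<n 1≤p p≤n∸1)
                   (≤-reflexive (≡-sym (clears⇒∣greens∣≡n H P clears)))
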